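{- Let $l$ and $q$ be odd primes with $q\equiv 1\pmod l$, and let $z\in\mathbb{F}_q$ with $z\neq 0,1$. The curve $\mathcal{C}_z: y^l=t(1-t)^{l-1}(1-zt)$ is birationally equivalent over $\mathbb{F}_q$ to the curve $$\mathcal{C}: Y^2=X^{2l}+2(1-2z)X^l+1.$$ -}

module Defs where

open import Data.Nat as ℕ using (ℕ; zero; suc; _∸_)
open import Data.Integer as ℤ using (ℤ; +_; 0ℤ; 1ℤ)
open import Data.Integer.Divisibility using (_∣_)
open import Data.Product using (_×_; _,_; proj₁; proj₂; ∃)
open import Relation.Nullary using (¬_)
open import Relation.Binary.PropositionalEquality using (_≡_)

-- Congruence of integers modulo q  (so ℤ modulo a prime q models 𝔽_q)

_≡_mod_ : ℤ → ℤ → ℕ → Set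
a ≡ b mod q = (+ q) ∣ (a ℤ.- b)

-- Polynomials in two variables X, Y with integer coefficients,
-- given as expressions; their image in 𝔽_q[X,Y] is determined by
-- their coefficients reduced mod q.

infixl 6 _⊕_ _⊝_
infixl 7 _⊗_
infixr 8 _^^_

data Poly : Set where
  cst  : ℤ → Poly
  varX : Poly
  varY : Poly
  _⊕_  : Poly → Poly → Poly
  _⊗_  : Poly → Poly → Poly
  ⊖_   : Poly → Poly

_⊝_ : Poly → Poly → Poly
p ⊝ r = p ⊕ (⊖ r)

_^^_ : Poly → ℕ → Poly
p ^^ zero  = cst 1ℤ
p ^^ suc n = p ⊗ (p ^^ n)

sumTo : ℕ → (ℕ → ℤ) → ℤ
sumTo zero    f = f 0
sumTo (suc n) f = sumTo n f ℤ.+ f (suc n)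

isZero : ℕ → ℤ
isZero zero    = 1ℤ
isZero (suc _) = 0ℤ

isOne : ℕ → ℤ
isOne (suc zero) = 1ℤ
isOne _          = 0ℤ

coeff : Poly → ℕ → ℕ → ℤ
coeff (cst c) i j = c ℤ.* (isZero i ℤ.* isZero j)
coeff varX    i j = isOne i ℤ.* isZero j
coeff varY    i j = isZero i ℤ.* isOne j
coeff (p ⊕ r) i j = coeff p i j ℤ.+ coeff r i j
coeff (p ⊗ r) i j =
  sumTo i (λ a → sumTo j (λ b → coeff p a b ℤ.* coeff r (i ∸ a) (j ∸ b)))
coeff (⊖ p)   i j = ℤ.- coeff p i j

-- equality in 𝔽_q[X,Y]
_≈_over_ : Poly → Poly → ℕ → Set
p ≈ r over q = ∀ i j → coeff p i j ≡ coeff r i j mod q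

-- p lies in the ideal (F) of 𝔽_q[X,Y], i.e. p = 0 in 𝔽_q[X,Y]/(F)
InIdeal : ℕ → Poly → Poly → Set
InIdeal q F p = ∃ λ h → p ≈ h ⊗ F over q

-- Elements of the function field 𝔽_q(C) of the plane curve C : F = 0,
-- represented as fractions num/den of polynomials.

Frac : Set
Frac = Poly × Poly

num den : Frac → Poly
num = proj₁
den = proj₂

evalFrac : Poly → Frac → Frac → Frac
evalFrac (cst c) fx fy = cst c , cst 1ℤ
evalFrac varX    fx fy = fx
evalFrac varY    fx fy = fy
evalFrac (p ⊕ r) fx fy with evalFrac p fx fy | evalFrac r fx fy
... | (a , b) | (c , d) = a ⊗ d ⊕ c ⊗ b , b ⊗ d
evalFrac (p ⊗ r) fx fy with evalFrac p fx fy | evalFrac r fx fy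
... | (a , b) | (c , d) = a ⊗ c , b ⊗ d
evalFrac (⊖ p)   fx fy with evalFrac p fx fy
... | (a , b) = ⊖ a , b

Defined : ℕ → Poly → Frac → Set
Defined q F f = ¬ InIdeal q F (den f)

FracEq : ℕ → Poly → Frac → Frac → Set
FracEq q F f g = InIdeal q F (num f ⊗ den g ⊝ num g ⊗ den f)

-- Rational maps between plane curves over 𝔽_q.
-- A rational map C₁ ⇢ C₂ (C_i : F_i(X,Y) = 0) is a pair (φX, φY) of
-- elements of 𝔽_q(C₁) with F₂(φX, φY) = 0 in 𝔽_q(C₁).

RatMap : Set
RatMap = Frac × Frac

IsRationalMap : ℕ → Poly → Poly → RatMap → Set
IsRationalMap q F₁ F₂ (φX , φY) =
  Defined q F₁ φX × Defined q F₁ φY ×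
  InIdeal q F₁ (num (evalFrac F₂ φX φY))

-- ψ ∘ φ is defined and equals the identity of C₁ (as a rational map):
-- substituting φ into the components of ψ gives X resp. Y in 𝔽_q(C₁).
-- Here ψ : C₂ ⇢ C₁ and φ : C₁ ⇢ C₂.
CompIsId : ℕ → Poly → RatMap → RatMap → Set
CompIsId q F₁ (φX , φY) (ψX , ψY) =
  compId ψX varX × compId ψY varY
  where
  -- the composite of the component n/d of ψ with φ is N/D, where
  -- N = n(φX,φY) and D = d(φX,φY); it is defined iff D ≠ 0 in 𝔽_q(C₁),
  -- and equals v iff N = v·D in 𝔽_q(C₁).
  compId : Frac → Poly → Set
  compId (n , d) v =
    let N = evalFrac n φX φY
        D = evalFrac d φX φY
    in ¬ InIdeal q F₁ (num D)
     × InIdeal q F₁ (num N ⊗ den D ⊝ v ⊗ den N ⊗ num D)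

BirationallyEquivalent : ℕ → Poly → Poly → Set
BirationallyEquivalent q F₁ F₂ =
  ∃ λ (φ : RatMap) → ∃ λ (ψ : RatMap) →
    IsRationalMap q F₁ F₂ φ × IsRationalMap q F₂ F₁ ψ ×
    CompIsId q F₁ φ ψ × CompIsId q F₂ ψ φ

-- 𝒞_z : y^l = t (1-t)^(l-1) (1 - z t),   with t = X, y = Y
curveCz : ℕ → ℤ → Poly
curveCz l z =
  varY ^^ l ⊝ varX ⊗ (cst 1ℤ ⊝ varX) ^^ (l ∸ 1) ⊗ (cst 1ℤ ⊝ cst z ⊗ varX)

curveC : ℕ → ℤ → Poly
curveC l z =
  varY ^^ 2 ⊝ (varX ^^ (2 ℕ.* l)
               ⊕ cst (+ 2 ℤ.* (1ℤ ℤ.- + 2 ℤ.* z)) ⊗ varX ^^ l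
               ⊕ cst 1ℤ)

module Submission where

-- The maps are explicit.  With s = 1 - t put X = y/s; on 𝒞_z we have
-- u := X^l = t(1-zt)/s, and Y = 2zt - 1 - u satisfies
-- Y² - u² - 2(1-2z)u - 1 = 4zt(zt-1) + 4zus = 0.  Conversely
-- t = (Y + 1 + X^l)/2z and y = X(1-t).

open import Defs
open import Data.Nat using (ℕ; _%_; _∸_)
open import Data.Nat.Divisibility using (_∣_)
open import Data.Nat.Primality using (Prime)
open import Data.Integer using (ℤ; 0ℤ; 1ℤ)
open import Relation.Nullary using (¬_)
open import Relation.Binary.PropositionalEquality using (_≡_)
open import Algebra.Bundles using (CommutativeRing)
open import Data.Nat using (zero; suc)
open import Data.Nat.Primality using (¬prime[0])
open import Data.Product using (_,_)
open import Relation.Nullary using (contradiction)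

-- The series again form a
-- commutative ring, so the construction can be iterated.
module PowerSeries {c ℓ} (R : CommutativeRing c ℓ) where

  import Algebra.Properties.AbelianGroup as AbelianGroupProperties
  import Algebra.Properties.CommutativeSemigroup as CommutativeSemigroupProperties
  open import Data.Nat as ℕ using (ℕ; zero; suc; _∸_; z≤n; s≤s)
  import Data.Nat.Properties as ℕP
  open import Data.Product using (_,_)
  open import Relation.Binary.PropositionalEquality as ≡ using (_≡_)
  open import Relation.Nullary using (yes; no)
  import Relation.Binary.Reasoning.Setoid as SetoidReasoning

  open CommutativeRing R
  open SetoidReasoning setoid
  open CommutativeSemigroupProperties +-commutativeSemigroup using (interchange)
  open AbelianGroupProperties +-abelianGroup using (⁻¹-∙-comm)

  sum : ℕ → (ℕ → Carrier) → Carrier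
  sum zero    f = f 0
  sum (suc n) f = sum n f + f (suc n)

  sum-congᵇ : ∀ n {f g : ℕ → Carrier} → (∀ k → k ℕ.≤ n → f k ≈ g k) → sum n f ≈ sum n g
  sum-congᵇ zero    f≈g = f≈g 0 z≤n
  sum-congᵇ (suc n) f≈g =
    +-cong (sum-congᵇ n (λ k k≤n → f≈g k (ℕP.m≤n⇒m≤1+n k≤n))) (f≈g (suc n) ℕP.≤-refl)

  sum-cong : ∀ n {f g : ℕ → Carrier} → (∀ k → f k ≈ g k) → sum n f ≈ sum n g
  sum-cong n f≈g = sum-congᵇ n (λ k _ → f≈g k)

  sum-≡ : ∀ {m n} (f : ℕ → Carrier) → m ≡ n → sum m f ≈ sum n f
  sum-≡ f ≡.refl = refl

  sum-+ : ∀ n (f g : ℕ → Carrier) → sum n (λ k → f k + g k) ≈ sum n f + sum n g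
  sum-+ zero    f g = refl
  sum-+ (suc n) f g = trans (+-cong (sum-+ n f g) refl) (interchange _ _ _ _)

  sum-neg : ∀ n (f : ℕ → Carrier) → sum n (λ k → - f k) ≈ - sum n f
  sum-neg zero    f = refl
  sum-neg (suc n) f = trans (+-cong (sum-neg n f) refl) (⁻¹-∙-comm _ _)

  sum-*ˡ : ∀ n x (f : ℕ → Carrier) → x * sum n f ≈ sum n (λ k → x * f k)
  sum-*ˡ zero    x f = refl
  sum-*ˡ (suc n) x f = trans (distribˡ x _ _) (+-cong (sum-*ˡ n x f) refl)

  sum-*ʳ : ∀ n x (f : ℕ → Carrier) → sum n f * x ≈ sum n (λ k → f k * x)
  sum-*ʳ zero    x f = refl
  sum-*ʳ (suc n) x f = trans (distribʳ x _ _) (+-cong (sum-*ʳ n x f) refl)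

  sum-0 : ∀ n → sum n (λ _ → 0#) ≈ 0#
  sum-0 zero    = refl
  sum-0 (suc n) = trans (+-cong (sum-0 n) refl) (+-identityˡ 0#)

  sum-shift : ∀ n (f : ℕ → Carrier) → sum (suc n) f ≈ f 0 + sum n (λ k → f (suc k))
  sum-shift zero    f = refl
  sum-shift (suc n) f = trans (+-cong (sum-shift n f) refl) (+-assoc _ _ _)

  sum-reverse : ∀ n (f : ℕ → Carrier) → sum n f ≈ sum n (λ k → f (n ∸ k))
  sum-reverse zero    f = refl
  sum-reverse (suc n) f = sym (begin
      sum (suc n) (λ k → f (suc n ∸ k))   ≈⟨ sum-shift n _ ⟩
      f (suc n) + sum n (λ k → f (n ∸ k)) ≈⟨ +-cong refl (sym (sum-reverse n f)) ⟩
      f (suc n) + sum n f                 ≈⟨ +-comm _ _ ⟩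
      sum (suc n) f                       ∎)

  VanishesBeyond : ℕ → (ℕ → Carrier) → Set ℓ
  VanishesBeyond B f = ∀ k → B ℕ.< k → f k ≈ 0#

  sum-beyond-support : ∀ B (f : ℕ → Carrier) → VanishesBeyond B f →
                       ∀ n → B ℕ.≤ n → sum n f ≈ sum B f
  sum-beyond-support B f vanish n B≤n =
    trans (sum-≡ f (≡.sym (ℕP.m+[n∸m]≡n B≤n))) (extend (n ∸ B))
    where
    extend : ∀ d → sum (B ℕ.+ d) f ≈ sum B f
    extend zero    = sum-≡ f (ℕP.+-identityʳ B)
    extend (suc d) = trans (sum-≡ f (ℕP.+-suc B d))
      (trans (+-cong (extend d) (vanish _ (s≤s (ℕP.m≤m+n B d)))) (+-identityʳ _))

  sum-triangle : ∀ n (F : ℕ → ℕ → Carrier) →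
    sum n (λ a → sum a (λ c → F c a)) ≈ sum n (λ c → sum (n ∸ c) (λ d → F c (c ℕ.+ d)))
  sum-triangle zero    F = refl
  sum-triangle (suc n) F = sym (begin
      sum n (λ c → sum (suc n ∸ c) (λ d → F c (c ℕ.+ d)))
        + sum (n ∸ n) (λ d → F (suc n) (suc n ℕ.+ d))
    ≈⟨ +-cong (sum-congᵇ n lastColumn) lastRow ⟩
      sum n (λ c → sum (n ∸ c) (λ d → F c (c ℕ.+ d)) + F c (suc n)) + F (suc n) (suc n)
    ≈⟨ trans (+-cong (sum-+ n _ _) refl) (+-assoc _ _ _) ⟩
      sum n (λ c → sum (n ∸ c) (λ d → F c (c ℕ.+ d))) + sum (suc n) (λ c → F c (suc n))
    ≈⟨ +-cong (sym (sum-triangle n F)) refl ⟩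
      sum (suc n) (λ a → sum a (λ c → F c a)) ∎)
    where
    lastColumn : ∀ c → c ℕ.≤ n → sum (suc n ∸ c) (λ d → F c (c ℕ.+ d))
                               ≈ sum (n ∸ c) (λ d → F c (c ℕ.+ d)) + F c (suc n)
    lastColumn c c≤n = trans (sum-≡ _ (ℕP.+-∸-assoc 1 c≤n)) (+-cong refl (reflexive
      (≡.cong (F c) (≡.trans (ℕP.+-suc c (n ∸ c)) (≡.cong suc (ℕP.m+[n∸m]≡n c≤n))))))
    lastRow : sum (n ∸ n) (λ d → F (suc n) (suc n ℕ.+ d)) ≈ F (suc n) (suc n)
    lastRow = trans (sum-≡ _ (ℕP.n∸n≡0 n)) (reflexive (≡.cong (F (suc n)) (ℕP.+-identityʳ (suc n))))

  Series : Set c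
  Series = ℕ → Carrier

  infix  4 _≋_
  infixl 6 _⊞_
  infixl 7 _⊠_

  _≋_ : Series → Series → Set ℓ
  f ≋ g = ∀ n → f n ≈ g n

  _⊞_ _⊠_ : Series → Series → Series
  (f ⊞ g) n = f n + g n
  (f ⊠ g) n = sum n (λ a → f a * g (n ∸ a))

  ⊟_ : Series → Series
  (⊟ f) n = - f n

  constant : Carrier → Series
  constant x zero    = x
  constant x (suc _) = 0#

  ⊠-constant : ∀ f x → f ⊠ constant x ≋ λ n → f n * x
  ⊠-constant f x zero    = refl
  ⊠-constant f x (suc n) = begin
      sum n (λ k → f k * constant x (suc n ∸ k)) + f (suc n) * constant x (n ∸ n)
    ≈⟨ +-cong (sum-congᵇ n (λ k k≤n → trans
         (*-cong refl (reflexive (≡.cong (constant x) (ℕP.+-∸-assoc 1 k≤n)))) (zeroʳ _)))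
       (*-cong refl (reflexive (≡.cong (constant x) (ℕP.n∸n≡0 n)))) ⟩
      sum n (λ _ → 0#) + f (suc n) * x
    ≈⟨ trans (+-cong (sum-0 n) refl) (+-identityˡ _) ⟩
      f (suc n) * x ∎

  ⊠-comm : ∀ f g → f ⊠ g ≋ g ⊠ f
  ⊠-comm f g n = trans (sum-reverse n _) (sum-congᵇ n (λ k k≤n →
    trans (*-cong refl (reflexive (≡.cong g (ℕP.m∸[m∸n]≡n k≤n)))) (*-comm _ _)))

  ⊠-identityʳ : ∀ f → f ⊠ constant 1# ≋ f
  ⊠-identityʳ f n = trans (⊠-constant f 1# n) (*-identityʳ _)

  ⊠-distribˡ : ∀ f g h → f ⊠ (g ⊞ h) ≋ f ⊠ g ⊞ f ⊠ h
  ⊠-distribˡ f g h n = trans (sum-cong n (λ k → distribˡ _ _ _)) (sum-+ n _ _)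

  ⊠-assoc : ∀ f g h → (f ⊠ g) ⊠ h ≋ f ⊠ (g ⊠ h)
  ⊠-assoc f g h n = begin
      sum n (λ a → sum a (λ c → f c * g (a ∸ c)) * h (n ∸ a))
    ≈⟨ sum-cong n (λ a → sum-*ʳ a _ _) ⟩
      sum n (λ a → sum a (λ c → (f c * g (a ∸ c)) * h (n ∸ a)))
    ≈⟨ sum-triangle n _ ⟩
      sum n (λ c → sum (n ∸ c) (λ d → (f c * g ((c ℕ.+ d) ∸ c)) * h (n ∸ (c ℕ.+ d))))
    ≈⟨ sum-cong n (λ c → sum-cong (n ∸ c) (λ d → trans
         (*-cong (*-cong refl (reflexive (≡.cong g (ℕP.m+n∸m≡n c d))))
                 (reflexive (≡.cong h (≡.sym (ℕP.∸-+-assoc n c d)))))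
         (*-assoc _ _ _))) ⟩
      sum n (λ c → sum (n ∸ c) (λ d → f c * (g d * h ((n ∸ c) ∸ d))))
    ≈⟨ sum-cong n (λ c → sym (sum-*ˡ (n ∸ c) _ _)) ⟩
      sum n (λ c → f c * sum (n ∸ c) (λ d → g d * h ((n ∸ c) ∸ d))) ∎

  ⊠-cong : ∀ {f f′ g g′} → f ≋ f′ → g ≋ g′ → f ⊠ g ≋ f′ ⊠ g′
  ⊠-cong f≋f′ g≋g′ n = sum-cong n (λ k → *-cong (f≋f′ k) (g≋g′ (n ∸ k)))

  seriesRing : CommutativeRing c ℓ
  seriesRing = record
    { Carrier = Series ; _≈_ = _≋_ ; _+_ = _⊞_ ; _*_ = _⊠_ ; -_ = ⊟_
    ; 0# = λ _ → 0# ; 1# = constant 1#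
    ; isCommutativeRing = record
      { isRing = record
        { +-isAbelianGroup = record
          { isGroup = record
            { isMonoid = record
              { isSemigroup = record
                { isMagma = record
                  { isEquivalence = record
                    { refl  = λ n → refl
                    ; sym   = λ f≋g n → sym (f≋g n)
                    ; trans = λ f≋g g≋h n → trans (f≋g n) (g≋h n) }
                  ; ∙-cong = λ f≋f′ g≋g′ n → +-cong (f≋f′ n) (g≋g′ n) }
                ; assoc = λ f g h n → +-assoc _ _ _ }
              ; identity = (λ f n → +-identityˡ _) , (λ f n → +-identityʳ _) }
            ; inverse = (λ f n → -‿inverseˡ _) , (λ f n → -‿inverseʳ _)
            ; ⁻¹-cong = λ f≋g n → -‿cong (f≋g n) }
          ; comm = λ f g n → +-comm _ _ }
        ; *-cong = ⊠-cong
        ; *-assoc = ⊠-assoc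
        ; *-identity = (λ f n → trans (⊠-comm _ f n) (⊠-identityʳ f n)) , ⊠-identityʳ
        ; distrib = ⊠-distribˡ , λ h f g n → trans (⊠-comm (f ⊞ g) h n)
            (trans (⊠-distribˡ h f g n) (+-cong (⊠-comm h f n) (⊠-comm h g n))) }
      ; *-comm = ⊠-comm } }

  private
    complement-≥ : ∀ a A B n → a ℕ.≤ A → A ℕ.+ B ℕ.≤ n → B ℕ.≤ n ∸ a
    complement-≥ a A B n a≤A A+B≤n = ℕP.≤-trans (ℕP.≤-reflexive (≡.sym (ℕP.m+n∸m≡n a B)))
      (ℕP.∸-monoˡ-≤ a (ℕP.≤-trans (ℕP.+-monoˡ-≤ B a≤A) A+B≤n))

  ⊠-vanishesBeyond : ∀ A B {f g} → VanishesBeyond A f → VanishesBeyond B g →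
                     VanishesBeyond (A ℕ.+ B) (f ⊠ g)
  ⊠-vanishesBeyond A B {f} {g} f-vanishes g-vanishes n A+B<n =
    trans (sum-congᵇ n term) (sum-0 n)
    where
    term : ∀ a → a ℕ.≤ n → f a * g (n ∸ a) ≈ 0#
    term a a≤n with a ℕ.≤? A
    ... | yes a≤A = trans (*-cong refl (g-vanishes (n ∸ a)
            (complement-≥ a A (suc B) n a≤A (ℕP.≤-trans (ℕP.≤-reflexive (ℕP.+-suc A B)) A+B<n))))
          (zeroʳ _)
    ... | no  a≰A = trans (*-cong (f-vanishes a (ℕP.≰⇒> a≰A)) refl) (zeroˡ _)

  sum-⊠ : ∀ A B {f g} → VanishesBeyond A f → VanishesBeyond B g →
          ∀ N → A ℕ.+ B ℕ.≤ N → sum N (f ⊠ g) ≈ sum A f * sum B g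
  sum-⊠ A B {f} {g} f-vanishes g-vanishes N A+B≤N = begin
      sum N (λ n → sum n (λ a → f a * g (n ∸ a)))
    ≈⟨ sum-triangle N (λ a n → f a * g (n ∸ a)) ⟩
      sum N (λ c → sum (N ∸ c) (λ d → f c * g ((c ℕ.+ d) ∸ c)))
    ≈⟨ sum-cong N (λ c → trans
         (sum-cong (N ∸ c) (λ d → *-cong refl (reflexive (≡.cong g (ℕP.m+n∸m≡n c d)))))
         (sym (sum-*ˡ (N ∸ c) (f c) g))) ⟩
      sum N (λ c → f c * sum (N ∸ c) g)
    ≈⟨ sum-congᵇ N term ⟩
      sum N (λ c → f c * sum B g)
    ≈⟨ sym (sum-*ʳ N _ f) ⟩
      sum N f * sum B g
    ≈⟨ *-cong (sum-beyond-support A f f-vanishes N (ℕP.m+n≤o⇒m≤o A A+B≤N)) refl ⟩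
      sum A f * sum B g ∎
    where
    term : ∀ c → c ℕ.≤ N → f c * sum (N ∸ c) g ≈ f c * sum B g
    term c c≤N with c ℕ.≤? A
    ... | yes c≤A = *-cong refl (sum-beyond-support B g g-vanishes (N ∸ c) (complement-≥ c A B N c≤A A+B≤N))
    ... | no  c≰A = let fc≈0 = f-vanishes c (ℕP.≰⇒> c≰A) in
      trans (*-cong fc≈0 refl) (trans (zeroˡ _) (sym (trans (*-cong fc≈0 refl) (zeroˡ _))))

-- Poly, identified up to equality of all integer coefficients, is a
-- commutative ring: coefficient extraction embeds it into ℤ[[Y]][[X]]
-- (outer index = power of X), compatibly with ⊕, ⊗ and ⊖.  This makes
-- the standard ring solver available for identities between polynomials.
module PolynomialRing where

  open import Defs
  open import Algebra.Bundles using (CommutativeRing; RawRing)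
  import Algebra.Morphism.RingMonomorphism as RingMonomorphism
  open import Algebra.Morphism.Structures using (IsRingMonomorphism)
  open import Algebra.Solver.Ring.AlmostCommutativeRing
    using (fromCommutativeRing; _-Raw-AlmostCommutative⟶_)
  open import Data.Integer as ℤ using (ℤ; 0ℤ; 1ℤ)
  import Data.Integer.Properties as ℤP
  open import Data.Integer.Tactic.RingSolver using (solve-∀)
  open import Data.Maybe using (Maybe; just; nothing)
  open import Data.Nat using (ℕ; zero; suc; _∸_)
  open import Relation.Binary.PropositionalEquality as ≡ using (_≡_; refl)
  open import Relation.Nullary using (yes; no)

  module ℤ[[Y]] = PowerSeries ℤP.+-*-commutativeRing
  module ℤ[[Y]][[X]] = PowerSeries ℤ[[Y]].seriesRing

  coefficients : Poly → ℤ[[Y]][[X]].Series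
  coefficients p i j = coeff p i j

  -- equality of all coefficients over ℤ (a record, so that it is not unfolded)
  infix 4 _≗_
  record _≗_ (p r : Poly) : Set where
    constructor same-coefficients
    field coefficients-≡ : coefficients p ℤ[[Y]][[X]].≋ coefficients r
  open _≗_ public

  sum≡sumTo : ∀ n f → ℤ[[Y]].sum n f ≡ sumTo n f
  sum≡sumTo zero    f = refl
  sum≡sumTo (suc n) f = ≡.cong (ℤ._+ f (suc n)) (sum≡sumTo n f)

  sum≡sumToᶜ : ∀ n F j → ℤ[[Y]][[X]].sum n F j ≡ sumTo n (λ a → F a j)
  sum≡sumToᶜ zero    F j = refl
  sum≡sumToᶜ (suc n) F j = ≡.cong (ℤ._+ F (suc n) j) (sum≡sumToᶜ n F j)

  sumTo-cong : ∀ n {f g : ℕ → ℤ} → (∀ k → f k ≡ g k) → sumTo n f ≡ sumTo n g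
  sumTo-cong zero    f≡g = f≡g 0
  sumTo-cong (suc n) f≡g = ≡.cong₂ ℤ._+_ (sumTo-cong n f≡g) (f≡g (suc n))

  coefficients-⊗ : ∀ p r →
    coefficients (p ⊗ r) ℤ[[Y]][[X]].≋ coefficients p ℤ[[Y]][[X]].⊠ coefficients r
  coefficients-⊗ p r i j = ≡.sym (≡.trans
    (sum≡sumToᶜ i (λ a → coefficients p a ℤ[[Y]].⊠ coefficients r (i ∸ a)) j)
    (sumTo-cong i (λ a → sum≡sumTo j (λ b → coeff p a b ℤ.* coeff r (i ∸ a) (j ∸ b)))))

  coefficients-cst : ∀ c →
    coefficients (cst c) ℤ[[Y]][[X]].≋ ℤ[[Y]][[X]].constant (ℤ[[Y]].constant c)
  coefficients-cst c zero    zero    = ℤP.*-identityʳ c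
  coefficients-cst c zero    (suc j) = ℤP.*-zeroʳ c
  coefficients-cst c (suc i) j       = ≡.trans (≡.cong (c ℤ.*_) (ℤP.*-zeroˡ (isZero j))) (ℤP.*-zeroʳ c)

  polynomialRawRing : RawRing _ _
  polynomialRawRing = record
    { Carrier = Poly ; _≈_ = _≗_ ; _+_ = _⊕_ ; _*_ = _⊗_ ; -_ = ⊖_
    ; 0# = cst 0ℤ ; 1# = cst 1ℤ }

  coefficients-isRingMonomorphism :
    IsRingMonomorphism polynomialRawRing (CommutativeRing.rawRing ℤ[[Y]][[X]].seriesRing) coefficients
  coefficients-isRingMonomorphism = record
    { isRingHomomorphism = record
      { isSemiringHomomorphism = record
        { isNearSemiringHomomorphism = record
          { +-isMonoidHomomorphism = record
            { isMagmaHomomorphism = record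
              { isRelHomomorphism = record { cong = coefficients-≡ }
              ; homo = λ p r i j → refl }
            ; ε-homo = λ i j → ℤP.*-zeroˡ (isZero i ℤ.* isZero j) }
          ; *-homo = coefficients-⊗ }
        ; 1#-homo = coefficients-cst 1ℤ }
      ; -‿homo = λ p i j → refl }
    ; injective = same-coefficients }

  polynomialRing : CommutativeRing _ _
  polynomialRing = record
    { isCommutativeRing = RingMonomorphism.isCommutativeRing coefficients-isRingMonomorphism
        (CommutativeRing.isCommutativeRing ℤ[[Y]][[X]].seriesRing) }

  open CommutativeRing polynomialRing public using ()
    renaming (refl to ≗-refl; sym to ≗-sym; trans to ≗-trans; reflexive to ≗-reflexive;
              +-cong to ⊕-cong; *-cong to ⊗-cong; -‿cong to ⊖-cong;
              *-identityˡ to ⊗-identityˡ; zeroˡ to ⊗-zeroˡ)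

  -- products of constants, needed to use integers as solver coefficients
  cst-* : ∀ a b → cst (a ℤ.* b) ≗ cst a ⊗ cst b
  cst-* a b = same-coefficients λ i j → ≡.sym (begin
      coeff (cst a ⊗ cst b) i j
    ≡⟨ coefficients-⊗ (cst a) (cst b) i j ⟩
      (coefficients (cst a) ℤ[[Y]][[X]].⊠ coefficients (cst b)) i j
    ≡⟨ ℤ[[Y]][[X]].⊠-cong {coefficients (cst a)} (λ _ _ → refl) (coefficients-cst b) i j ⟩
      (coefficients (cst a) ℤ[[Y]][[X]].⊠ ℤ[[Y]][[X]].constant (ℤ[[Y]].constant b)) i j
    ≡⟨ ℤ[[Y]][[X]].⊠-constant (coefficients (cst a)) (ℤ[[Y]].constant b) i j ⟩
      (coefficients (cst a) i ℤ[[Y]].⊠ ℤ[[Y]].constant b) j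
    ≡⟨ ℤ[[Y]].⊠-constant (coefficients (cst a) i) b j ⟩
      (a ℤ.* (isZero i ℤ.* isZero j)) ℤ.* b
    ≡⟨ rearrange a b (isZero i ℤ.* isZero j) ⟩
      (a ℤ.* b) ℤ.* (isZero i ℤ.* isZero j) ∎)
    where
    open ≡.≡-Reasoning
    rearrange : ∀ a b w → (a ℤ.* w) ℤ.* b ≡ (a ℤ.* b) ℤ.* w
    rearrange = solve-∀

  constants : ℤ.+-*-rawRing -Raw-AlmostCommutative⟶ fromCommutativeRing polynomialRing
  constants = record
    { ⟦_⟧    = cst
    ; +-homo = λ a b → same-coefficients λ i j → ℤP.*-distribʳ-+ (isZero i ℤ.* isZero j) a b
    ; *-homo = cst-*
    ; -‿homo = λ a → same-coefficients λ i j → ≡.sym (ℤP.neg-distribˡ-* a (isZero i ℤ.* isZero j))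
    ; 0-homo = same-coefficients λ i j → refl
    ; 1-homo = same-coefficients λ i j → refl }

  constants-equal? : ∀ a b → Maybe (cst a ≗ cst b)
  constants-equal? a b with a ℤ.≟ b
  ... | yes refl = just (same-coefficients λ i j → refl)
  ... | no _     = nothing

  open import Algebra.Solver.Ring ℤ.+-*-rawRing (fromCommutativeRing polynomialRing)
    constants constants-equal? public

-- Conversely, congruent polynomials take
-- congruent values at any point (0, b), so a polynomial that does not
-- vanish mod q at a point (0, b) of the curve F = 0 is not in (F).
module IdealMembership where

  open import Defs
  open PolynomialRing using (module ℤ[[Y]]; sum≡sumTo; _≗_; coefficients-≡; ≗-trans; ≗-sym; ⊗-zeroˡ)
  open import Data.Nat.Divisibility using (_∣0)
  open import Data.Integer as ℤ using (ℤ; +_; 0ℤ; 1ℤ; _^_)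
  import Data.Integer.Divisibility.Signed as Signed
  import Data.Integer.Properties as ℤP
  open import Data.Integer.Tactic.RingSolver using (solve-∀)
  open import Data.Nat as ℕ using (ℕ; zero; suc; _∸_; _⊔_; z≤n; s≤s)
  import Data.Nat.Properties as ℕP
  open import Data.Product using (_,_)
  open import Relation.Binary.PropositionalEquality as ≡ using (_≡_; refl)
  open import Relation.Nullary using (¬_)
  open ℤ[[Y]] using (sum; _⊠_; VanishesBeyond)

  ≗⇒≈ : ∀ q {p r} → p ≗ r → p ≈ r over q
  ≗⇒≈ q {p} {r} p≗r i j rewrite coefficients-≡ p≗r i j | ℤP.+-inverseʳ (coeff r i j) = q ∣0

  multiple-in-ideal : ∀ q {F p} h → p ≗ h ⊗ F → InIdeal q F p
  multiple-in-ideal q h p≗hF = h , ≗⇒≈ q p≗hF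

  zero-in-ideal : ∀ q F {p} → p ≗ cst 0ℤ → InIdeal q F p
  zero-in-ideal q F p≗0 = multiple-in-ideal q (cst 0ℤ) (≗-trans p≗0 (≗-sym (⊗-zeroˡ F)))

  valueAt : ℤ → Poly → ℤ
  valueAt b (cst c) = c
  valueAt b varX    = 0ℤ
  valueAt b varY    = b
  valueAt b (p ⊕ r) = valueAt b p ℤ.+ valueAt b r
  valueAt b (p ⊗ r) = valueAt b p ℤ.* valueAt b r
  valueAt b (⊖ p)   = ℤ.- valueAt b p

  valueAt-^^ : ∀ b p n → valueAt b (p ^^ n) ≡ valueAt b p ^ n
  valueAt-^^ b p zero    = refl
  valueAt-^^ b p (suc n) = ≡.cong (valueAt b p ℤ.*_) (valueAt-^^ b p n)

  column : Poly → ℕ → ℤ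
  column p j = coeff p 0 j

  degreeY : Poly → ℕ
  degreeY (cst _) = 0
  degreeY varX    = 0
  degreeY varY    = 1
  degreeY (p ⊕ r) = degreeY p ⊔ degreeY r
  degreeY (p ⊗ r) = degreeY p ℕ.+ degreeY r
  degreeY (⊖ p)   = degreeY p

  column-⊗ : ∀ p r j → column (p ⊗ r) j ≡ (column p ⊠ column r) j
  column-⊗ p r j = ≡.sym (sum≡sumTo j (λ b → coeff p 0 b ℤ.* coeff r 0 (j ∸ b)))

  column-vanishesBeyond : ∀ p → VanishesBeyond (degreeY p) (column p)
  column-vanishesBeyond (cst c) (suc j) _ = ℤP.*-zeroʳ c
  column-vanishesBeyond varX    j       _ = ℤP.*-zeroˡ (isZero j)
  column-vanishesBeyond varY    (suc zero) (s≤s ())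
  column-vanishesBeyond varY    (suc (suc j)) _ = refl
  column-vanishesBeyond (p ⊕ r) j deg<j = ≡.cong₂ ℤ._+_
    (column-vanishesBeyond p j (ℕP.≤-<-trans (ℕP.m≤m⊔n (degreeY p) (degreeY r)) deg<j))
    (column-vanishesBeyond r j (ℕP.≤-<-trans (ℕP.m≤n⊔m (degreeY p) (degreeY r)) deg<j))
  column-vanishesBeyond (p ⊗ r) j deg<j = ≡.trans (column-⊗ p r j)
    (ℤ[[Y]].⊠-vanishesBeyond (degreeY p) (degreeY r)
      (column-vanishesBeyond p) (column-vanishesBeyond r) j deg<j)
  column-vanishesBeyond (⊖ p)   j deg<j = ≡.cong ℤ.-_ (column-vanishesBeyond p j deg<j)

  weighted : ℤ → (ℕ → ℤ) → ℕ → ℤ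
  weighted b f j = f j ℤ.* b ^ j

  weighted-vanishesBeyond : ∀ b {B f} → VanishesBeyond B f → VanishesBeyond B (weighted b f)
  weighted-vanishesBeyond b f-vanishes j B<j =
    ≡.trans (≡.cong (ℤ._* b ^ j) (f-vanishes j B<j)) (ℤP.*-zeroˡ (b ^ j))

  weighted-⊠ : ∀ b f g n → weighted b (f ⊠ g) n ≡ (weighted b f ⊠ weighted b g) n
  weighted-⊠ b f g n = ≡.trans (ℤ[[Y]].sum-*ʳ n (b ^ n) _) (ℤ[[Y]].sum-congᵇ n split)
    where
    regroup : ∀ x y u v → (x ℤ.* y) ℤ.* (u ℤ.* v) ≡ (x ℤ.* u) ℤ.* (y ℤ.* v)
    regroup = solve-∀
    split : ∀ a → a ℕ.≤ n → (f a ℤ.* g (n ∸ a)) ℤ.* b ^ n ≡ weighted b f a ℤ.* weighted b g (n ∸ a)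
    split a a≤n = ≡.trans
      (≡.cong ((f a ℤ.* g (n ∸ a)) ℤ.*_)
        (≡.trans (≡.cong (b ^_) (≡.sym (ℕP.m+[n∸m]≡n a≤n))) (ℤP.^-distribˡ-+-* b a (n ∸ a))))
      (regroup (f a) (g (n ∸ a)) (b ^ a) (b ^ (n ∸ a)))

  valueAt-as-sum : ∀ b p N → degreeY p ℕ.≤ N → sum N (weighted b (column p)) ≡ valueAt b p
  valueAt-as-sum b (cst c) N _ = ≡.trans
    (ℤ[[Y]].sum-beyond-support 0 _ (weighted-vanishesBeyond b (column-vanishesBeyond (cst c))) N z≤n)
    (≡.trans (ℤP.*-identityʳ _) (ℤP.*-identityʳ c))
  valueAt-as-sum b varX N _ =
    ℤ[[Y]].sum-beyond-support 0 _ (weighted-vanishesBeyond b (column-vanishesBeyond varX)) N z≤n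
  valueAt-as-sum b varY N 1≤N = ≡.trans
    (ℤ[[Y]].sum-beyond-support 1 _ (weighted-vanishesBeyond b (column-vanishesBeyond varY)) N 1≤N)
    (linear b)
    where
    linear : ∀ b → 0ℤ ℤ.+ 1ℤ ℤ.* (b ℤ.* 1ℤ) ≡ b
    linear = solve-∀
  valueAt-as-sum b (p ⊕ r) N deg≤N = ≡.trans
    (ℤ[[Y]].sum-cong N (λ j → ℤP.*-distribʳ-+ (b ^ j) (column p j) (column r j)))
    (≡.trans (ℤ[[Y]].sum-+ N _ _) (≡.cong₂ ℤ._+_
      (valueAt-as-sum b p N (ℕP.≤-trans (ℕP.m≤m⊔n (degreeY p) (degreeY r)) deg≤N))
      (valueAt-as-sum b r N (ℕP.≤-trans (ℕP.m≤n⊔m (degreeY p) (degreeY r)) deg≤N))))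
  valueAt-as-sum b (p ⊗ r) N deg≤N = begin
      sum N (weighted b (column (p ⊗ r)))
    ≡⟨ ℤ[[Y]].sum-cong N (λ j → ≡.trans (≡.cong (ℤ._* b ^ j) (column-⊗ p r j))
                                          (weighted-⊠ b (column p) (column r) j)) ⟩
      sum N (weighted b (column p) ⊠ weighted b (column r))
    ≡⟨ ℤ[[Y]].sum-⊠ (degreeY p) (degreeY r)
         (weighted-vanishesBeyond b (column-vanishesBeyond p))
         (weighted-vanishesBeyond b (column-vanishesBeyond r)) N deg≤N ⟩
      sum (degreeY p) (weighted b (column p)) ℤ.* sum (degreeY r) (weighted b (column r))
    ≡⟨ ≡.cong₂ ℤ._*_ (valueAt-as-sum b p _ ℕP.≤-refl) (valueAt-as-sum b r _ ℕP.≤-refl) ⟩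
      valueAt b p ℤ.* valueAt b r ∎
    where open ≡.≡-Reasoning
  valueAt-as-sum b (⊖ p) N deg≤N = ≡.trans
    (ℤ[[Y]].sum-cong N (λ j → ≡.sym (ℤP.neg-distribˡ-* (column p j) (b ^ j))))
    (≡.trans (ℤ[[Y]].sum-neg N _) (≡.cong ℤ.-_ (valueAt-as-sum b p N deg≤N)))

  sum-divisible : ∀ {d} N (f : ℕ → ℤ) → (∀ j → d Signed.∣ f j) → d Signed.∣ sum N f
  sum-divisible zero    f d∣f = d∣f 0
  sum-divisible (suc N) f d∣f = Signed.∣m∣n⇒∣m+n (sum-divisible N f d∣f) (d∣f (suc N))

  valueAt-cong : ∀ q b {p r} → p ≈ r over q → (+ q) Signed.∣ (valueAt b p ℤ.- valueAt b r)
  valueAt-cong q b {p} {r} p≈r = ≡.subst ((+ q) Signed.∣_) difference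
    (sum-divisible N _ (λ j → Signed.∣m⇒∣m*n {m = column p j ℤ.- column r j} (b ^ j) (Signed.∣ᵤ⇒∣ (p≈r 0 j))))
    where
    N = degreeY p ⊔ degreeY r
    distrib : ∀ x y w → (x ℤ.- y) ℤ.* w ≡ x ℤ.* w ℤ.+ ℤ.- (y ℤ.* w)
    distrib = solve-∀
    difference : sum N (λ j → (column p j ℤ.- column r j) ℤ.* b ^ j) ≡ valueAt b p ℤ.- valueAt b r
    difference = ≡.trans (ℤ[[Y]].sum-cong N (λ j → distrib (column p j) (column r j) (b ^ j)))
      (≡.trans (ℤ[[Y]].sum-+ N _ _) (≡.cong₂ ℤ._+_
        (valueAt-as-sum b p N (ℕP.m≤m⊔n _ _))
        (≡.trans (ℤ[[Y]].sum-neg N _) (≡.cong ℤ.-_ (valueAt-as-sum b r N (ℕP.m≤n⊔m _ _))))))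

  not-in-ideal : ∀ q b F p → valueAt b F ≡ 0ℤ → ¬ ((+ q) Signed.∣ valueAt b p) → ¬ InIdeal q F p
  not-in-ideal q b F p F-vanishes p-nonzero (h , p≈hF) =
    p-nonzero (≡.subst ((+ q) Signed.∣_) value≡ (valueAt-cong q b {p} {h ⊗ F} p≈hF))
    where
    value≡ : valueAt b p ℤ.- valueAt b h ℤ.* valueAt b F ≡ valueAt b p
    value≡ rewrite F-vanishes | ℤP.*-zeroʳ (valueAt b h) = ℤP.+-identityʳ (valueAt b p)

-- The ring solver only
-- normalises closed exponents, and evalFrac gets stuck on p ^^ n for a
-- variable n.  Such stuck terms are therefore treated as atoms ρ; each
-- atom is explained by an expression ν over a few base atoms σ, and an
-- identity between atoms follows from a solver-checked identity after
-- substituting the explanations (solve-modulo).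
module SymbolicPowers where

  open import Defs
  open PolynomialRing
  open import Algebra.Solver.Ring.AlmostCommutativeRing using (AlmostCommutativeRing; fromCommutativeRing)
  import Algebra.Properties.Semiring.Exp as Exp
  open import Data.Integer using (ℤ; 1ℤ)
  open import Data.Nat as ℕ using (ℕ; zero; suc)
  open import Data.Fin using (Fin)
  open import Data.Product using (_×_; _,_)
  open import Data.Vec using (Vec; lookup)
  open import Data.Vec.Relation.Binary.Pointwise.Inductive as Pointwise using (Pointwise)
  open import Relation.Binary.PropositionalEquality using (_≡_; refl)

  open Exp (AlmostCommutativeRing.semiring (fromCommutativeRing polynomialRing)) using (^-congˡ)

  evalFrac-^^ : ∀ p n fx fy →
    evalFrac (p ^^ n) fx fy ≡ (num (evalFrac p fx fy) ^^ n , den (evalFrac p fx fy) ^^ n)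
  evalFrac-^^ p zero    fx fy = refl
  evalFrac-^^ p (suc n) fx fy rewrite evalFrac-^^ p n fx fy = refl

  ^^-cong : ∀ {p r} n → p ≗ r → p ^^ n ≗ r ^^ n
  ^^-cong zero    p≗r = ≗-refl
  ^^-cong (suc n) p≗r = ⊗-cong p≗r (^^-cong n p≗r)

  ^^-+ : ∀ p a b → p ^^ (a ℕ.+ b) ≗ p ^^ a ⊗ p ^^ b
  ^^-+ p zero    b = solve 1 (λ x → x := con 1ℤ :* x) ≗-refl (p ^^ b)
  ^^-+ p (suc a) b = ≗-trans (⊗-cong ≗-refl (^^-+ p a b))
    (solve 3 (λ x y z → x :* (y :* z) := (x :* y) :* z) ≗-refl p (p ^^ a) (p ^^ b))

  ^^-⊗ : ∀ p r n → (p ⊗ r) ^^ n ≗ p ^^ n ⊗ r ^^ n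
  ^^-⊗ p r zero    = solve 0 (con 1ℤ := con 1ℤ :* con 1ℤ) ≗-refl
  ^^-⊗ p r (suc n) = ≗-trans (⊗-cong ≗-refl (^^-⊗ p r n))
    (solve 4 (λ x y u v → (x :* y) :* (u :* v) := (x :* u) :* (y :* v)) ≗-refl p r (p ^^ n) (r ^^ n))

  substitute : ∀ {n k} → Polynomial n → Vec (Polynomial k) n → Polynomial k
  substitute (op o p r) ν = op o (substitute p ν) (substitute r ν)
  substitute (con c)    ν = con c
  substitute (var i)    ν = lookup ν i
  substitute (p :^ n)   ν = substitute p ν :^ n
  substitute (:- p)     ν = :- substitute p ν

  Explains : ∀ {n k} → Vec Poly n → Vec (Polynomial k) n → Vec Poly k → Set
  Explains ρ ν σ = Pointwise (λ atom e → atom ≗ ⟦ e ⟧ σ) ρ ν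

  substitute-correct : ∀ {n k} {ρ : Vec Poly n} {ν} {σ : Vec Poly k} → Explains ρ ν σ →
                       ∀ e → ⟦ e ⟧ ρ ≗ ⟦ substitute e ν ⟧ σ
  substitute-correct ρ≗ν (op [+] p r) = ⊕-cong (substitute-correct ρ≗ν p) (substitute-correct ρ≗ν r)
  substitute-correct ρ≗ν (op [*] p r) = ⊗-cong (substitute-correct ρ≗ν p) (substitute-correct ρ≗ν r)
  substitute-correct ρ≗ν (con c)      = ≗-refl
  substitute-correct ρ≗ν (var i)      = Pointwise.lookup ρ≗ν i
  substitute-correct ρ≗ν (p :^ n)     = ^-congˡ n (substitute-correct ρ≗ν p)
  substitute-correct ρ≗ν (:- p)       = ⊖-cong (substitute-correct ρ≗ν p)

  solve-modulo : ∀ {n k} (eL eR : Polynomial n) {ρ : Vec Poly n} {ν} {σ : Vec Poly k} →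
                 Explains ρ ν σ →
                 ⟦ substitute eL ν ⟧↓ σ ≗ ⟦ substitute eR ν ⟧↓ σ → ⟦ eL ⟧ ρ ≗ ⟦ eR ⟧ ρ
  solve-modulo eL eR {σ = σ} ρ≗ν normal-forms≗ =
    ≗-trans (substitute-correct ρ≗ν eL)
      (≗-trans (prove σ (substitute eL _) (substitute eR _) normal-forms≗)
        (≗-sym (substitute-correct ρ≗ν eR)))

  FracExpr : ℕ → Set _
  FracExpr n = Polynomial n × Polynomial n

  -- Curve expressions transcribe a polynomial in X, Y.  Their evaluation at
  -- fractions of solver expressions mirrors evalFrac step by step, so that
  -- ⟦ num (evalFracExpr e ex ey) ⟧ ρ is definitionally the numerator that
  -- evalFrac computes for the transcribed polynomial.
  data CurveExpr (n : ℕ) : Set where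
    con   : ℤ → CurveExpr n
    atom  : Fin n → CurveExpr n              -- a constant polynomial named by an atom
    X Y   : CurveExpr n
    _+_ _*_ : CurveExpr n → CurveExpr n → CurveExpr n
    -_    : CurveExpr n → CurveExpr n
    stuck : Fin n → Fin n → CurveExpr n      -- a fraction whose parts are atoms

  infixl 6 _+_
  infixl 7 _*_

  evalFracExpr : ∀ {n} → CurveExpr n → FracExpr n → FracExpr n → FracExpr n
  evalFracExpr (con c)     ex ey = con c , con 1ℤ
  evalFracExpr (atom i)    ex ey = var i , con 1ℤ
  evalFracExpr X           ex ey = ex
  evalFracExpr Y           ex ey = ey
  evalFracExpr (stuck i j) ex ey = var i , var j
  evalFracExpr (p + r)     ex ey with evalFracExpr p ex ey | evalFracExpr r ex ey
  ... | (a , b) | (c , d) = a :* d :+ c :* b , b :* d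
  evalFracExpr (p * r)     ex ey with evalFracExpr p ex ey | evalFracExpr r ex ey
  ... | (a , b) | (c , d) = a :* c , b :* d
  evalFracExpr (- p)       ex ey with evalFracExpr p ex ey
  ... | (a , b) = :- a , b

-- The two rational maps and the polynomial identities behind them, for
-- l = m + 1.  With s = 1 - t,
--   φ : 𝒞_z ⇢ 𝒞,  (t, y) ↦ (y / s, 2zt - 1 - (y / s)^l),
--   ψ : 𝒞 ⇢ 𝒞_z,  (X, Y) ↦ (t, X (1 - t))  where t = (Y + 1 + X^l) / 2z.
-- All identities already hold over ℤ.
module Maps (m : ℕ) (z : ℤ) where

  open import Defs
  open PolynomialRing
  open SymbolicPowers
  open import Data.Integer as ℤ using (ℤ; +_; 0ℤ; 1ℤ)
  open import Data.Fin using (#_)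
  open import Data.Nat as ℕ using (ℕ; suc)
  import Data.Nat.Properties as ℕP
  open import Data.Product using (_×_; _,_; proj₁; proj₂)
  open import Data.Vec using (Vec; []; _∷_)
  open import Data.Vec.Relation.Binary.Pointwise.Inductive using ([]; _∷_)
  open import Algebra.Solver.Ring.AlmostCommutativeRing using (_-Raw-AlmostCommutative⟶_)
  open import Relation.Binary.PropositionalEquality as ≡ using (_≡_)

  l : ℕ
  l = suc m

  F₁ F₂ : Poly
  F₁ = curveCz l z
  F₂ = curveC l z

  s : Poly
  s = cst 1ℤ ⊝ varX

  φX φY : Frac
  φX = varY , s
  φY = cst (+ 2) ⊗ cst z ⊗ varX ⊗ s ^^ l ⊝ s ^^ l ⊝ varY ^^ l , s ^^ l

  -- t = T / D, and W / D = 1 - t in the form produced by evalFrac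
  D T W : Poly
  D = cst (+ 2) ⊗ cst z
  T = varY ⊕ cst 1ℤ ⊕ varX ^^ l
  W = cst 1ℤ ⊗ D ⊕ ⊖ T ⊗ cst 1ℤ

  ψX ψY : Frac
  ψX = T , D
  ψY = varX ⊗ W , cst 1ℤ ⊗ D

  K : ℤ
  K = + 2 ℤ.* (1ℤ ℤ.- + 2 ℤ.* z)

  K-expanded : cst K ≗ cst (+ 2) ⊗ (cst 1ℤ ⊕ ⊖ (cst (+ 2) ⊗ cst z))
  K-expanded = ≗-trans (*-homo (+ 2) _) (⊗-cong ≗-refl
    (≗-trans (+-homo 1ℤ _) (⊕-cong ≗-refl (≗-trans (-‿homo _) (⊖-cong (*-homo (+ 2) z))))))
    where open _-Raw-AlmostCommutative⟶_ constants

  -- X^(2l) unfolds to X ⊗ X^(m + l), and m + l = m + 1 + m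
  m+l : ℕ
  m+l = m ℕ.+ suc (m ℕ.+ 0)

  ^^-m+l : ∀ p → p ^^ m+l ≗ p ^^ m ⊗ (p ⊗ p ^^ m)
  ^^-m+l p = ≗-trans (^^-+ p m (suc (m ℕ.+ 0)))
    (⊗-cong ≗-refl (⊗-cong ≗-refl (≗-reflexive (≡.cong (p ^^_) (ℕP.+-identityʳ m)))))

  defect : Frac → Poly → Frac → Frac → Poly
  defect (n , d) v fx fy = num N ⊗ den D′ ⊝ v ⊗ den N ⊗ num D′
    where N = evalFrac n fx fy
          D′ = evalFrac d fx fy

  defectExpr : ∀ {n} → CurveExpr n × CurveExpr n → Polynomial n → FracExpr n → FracExpr n → Polynomial n
  defectExpr (nᵉ , dᵉ) v ex ey = proj₁ N :* proj₂ D′ :- v :* proj₂ N :* proj₁ D′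
    where N = evalFracExpr nᵉ ex ey
          D′ = evalFracExpr dᵉ ex ey

  -- Identities on 𝒞_z, i.e. after substituting φ.  The atoms are
  -- 0 X, 1 Y, 2 z, 3 Y^m, 4 s^m, 5/6 X^m at φ, 7/8 X^(m+l) at φ, 9 K.
  module AfterΦ where

    atoms : Vec Poly 10
    atoms = varX ∷ varY ∷ cst z ∷ varY ^^ m ∷ s ^^ m
          ∷ num (evalFrac (varX ^^ m) φX φY) ∷ den (evalFrac (varX ^^ m) φX φY)
          ∷ num (evalFrac (varX ^^ m+l) φX φY) ∷ den (evalFrac (varX ^^ m+l) φX φY)
          ∷ cst K ∷ []

    base : Vec Poly 5
    base = varX ∷ varY ∷ cst z ∷ varY ^^ m ∷ s ^^ m ∷ []

    explanations : Vec (Polynomial 5) 10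
    explanations = x₀ ∷ y₀ ∷ z₀ ∷ yᵐ₀ ∷ sᵐ₀ ∷ yᵐ₀ ∷ sᵐ₀ ∷ yᵐ₀ :* (y₀ :* yᵐ₀) ∷ sᵐ₀ :* ((con 1ℤ :- x₀) :* sᵐ₀)
                 ∷ con (+ 2) :* (con 1ℤ :- con (+ 2) :* z₀) ∷ []
      where
      x₀ y₀ z₀ yᵐ₀ sᵐ₀ : Polynomial 5
      x₀ = var (# 0) ; y₀ = var (# 1) ; z₀ = var (# 2) ; yᵐ₀ = var (# 3) ; sᵐ₀ = var (# 4)

    explained : Explains atoms explanations base
    explained = ≗-refl ∷ ≗-refl ∷ ≗-refl ∷ ≗-refl ∷ ≗-refl
              ∷ ≗-reflexive (≡.cong proj₁ (evalFrac-^^ varX m φX φY))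
              ∷ ≗-reflexive (≡.cong proj₂ (evalFrac-^^ varX m φX φY))
              ∷ ≗-trans (≗-reflexive (≡.cong proj₁ (evalFrac-^^ varX m+l φX φY))) (^^-m+l varY)
              ∷ ≗-trans (≗-reflexive (≡.cong proj₂ (evalFrac-^^ varX m+l φX φY))) (^^-m+l s)
              ∷ K-expanded ∷ []

    x y zᵃ yᵐ sᵐ sᵉ : Polynomial 10
    x = var (# 0) ; y = var (# 1) ; zᵃ = var (# 2) ; yᵐ = var (# 3) ; sᵐ = var (# 4)
    sᵉ = con 1ℤ :- x

    F₁ᵉ : Polynomial 10
    F₁ᵉ = y :* yᵐ :- x :* sᵐ :* (con 1ℤ :- zᵃ :* x)

    φᵉX φᵉY : FracExpr 10
    φᵉX = y , sᵉ
    φᵉY = con (+ 2) :* zᵃ :* x :* (sᵉ :* sᵐ) :- sᵉ :* sᵐ :- y :* yᵐ , sᵉ :* sᵐ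

    F₂ᶜ : CurveExpr 10
    F₂ᶜ = Y * (Y * con 1ℤ) + - (X * stuck (# 7) (# 8) + atom (# 9) * (X * stuck (# 5) (# 6)) + con 1ℤ)

    Tᶜ Dᶜ : CurveExpr 10
    Tᶜ = Y + con 1ℤ + X * stuck (# 5) (# 6)
    Dᶜ = con (+ 2) * atom (# 2)

    F₂∘φ : num (evalFrac F₂ φX φY) ≗ cst (+ 4) ⊗ cst z ⊗ (s ^^ l ⊗ s ^^ l ⊗ s ^^ l ⊗ s ^^ l) ⊗ s ⊗ F₁
    F₂∘φ = solve-modulo (proj₁ (evalFracExpr F₂ᶜ φᵉX φᵉY))
      (con (+ 4) :* zᵃ :* (sᵉ :* sᵐ :* (sᵉ :* sᵐ) :* (sᵉ :* sᵐ) :* (sᵉ :* sᵐ)) :* sᵉ :* F₁ᵉ)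
      explained ≗-refl

    ψX∘φ : defect ψX varX φX φY ≗ cst 0ℤ
    ψX∘φ = solve-modulo (defectExpr (Tᶜ , Dᶜ) x φᵉX φᵉY) (con 0ℤ) explained ≗-refl

    ψY∘φ : defect ψY varY φX φY ≗ cst 0ℤ
    ψY∘φ = solve-modulo (defectExpr (X * (con 1ℤ * Dᶜ + (- Tᶜ) * con 1ℤ) , con 1ℤ * Dᶜ) y φᵉX φᵉY)
      (con 0ℤ) explained ≗-refl

  -- Identities on 𝒞, i.e. after substituting ψ.  The atoms are
  -- 0 X, 1 Y, 2 z, 3 X^m, 4 K, 5/6 Y^m at ψ, 7/8 s^m at ψ, 9 X^(m+l).
  module AfterΨ where

    atoms : Vec Poly 10
    atoms = varX ∷ varY ∷ cst z ∷ varX ^^ m ∷ cst K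
          ∷ num (evalFrac (varY ^^ m) ψX ψY) ∷ den (evalFrac (varY ^^ m) ψX ψY)
          ∷ num (evalFrac (s ^^ m) ψX ψY) ∷ den (evalFrac (s ^^ m) ψX ψY)
          ∷ varX ^^ m+l ∷ []

    base : Vec Poly 6
    base = varX ∷ varY ∷ cst z ∷ varX ^^ m ∷ W ^^ m ∷ D ^^ m ∷ []

    explanations : Vec (Polynomial 6) 10
    explanations = x₀ ∷ y₀ ∷ z₀ ∷ xᵐ₀ ∷ con (+ 2) :* (con 1ℤ :- con (+ 2) :* z₀)
                 ∷ xᵐ₀ :* wᵐ₀ ∷ dᵐ₀ ∷ wᵐ₀ ∷ dᵐ₀ ∷ xᵐ₀ :* (x₀ :* xᵐ₀) ∷ []
      where
      x₀ y₀ z₀ xᵐ₀ wᵐ₀ dᵐ₀ : Polynomial 6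
      x₀ = var (# 0) ; y₀ = var (# 1) ; z₀ = var (# 2)
      xᵐ₀ = var (# 3) ; wᵐ₀ = var (# 4) ; dᵐ₀ = var (# 5)

    explained : Explains atoms explanations base
    explained = ≗-refl ∷ ≗-refl ∷ ≗-refl ∷ ≗-refl ∷ K-expanded
              ∷ ≗-trans (≗-reflexive (≡.cong proj₁ (evalFrac-^^ varY m ψX ψY))) (^^-⊗ varX W m)
              ∷ ≗-trans (≗-reflexive (≡.cong proj₂ (evalFrac-^^ varY m ψX ψY))) 1⊗D^m
              ∷ ≗-reflexive (≡.cong proj₁ (evalFrac-^^ s m ψX ψY))
              ∷ ≗-trans (≗-reflexive (≡.cong proj₂ (evalFrac-^^ s m ψX ψY))) 1⊗D^m
              ∷ ^^-m+l varX ∷ []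
      where
      1⊗D^m : (cst 1ℤ ⊗ D) ^^ m ≗ D ^^ m
      1⊗D^m = ^^-cong m (⊗-identityˡ D)

    x y zᵃ xᵐ Kᵃ : Polynomial 10
    x = var (# 0) ; y = var (# 1) ; zᵃ = var (# 2) ; xᵐ = var (# 3) ; Kᵃ = var (# 4)

    F₂ᵉ : Polynomial 10
    F₂ᵉ = y :* (y :* con 1ℤ) :- (x :* var (# 9) :+ Kᵃ :* (x :* xᵐ) :+ con 1ℤ)

    Tᵉ Dᵉ Wᵉ : Polynomial 10
    Tᵉ = y :+ con 1ℤ :+ x :* xᵐ
    Dᵉ = con (+ 2) :* zᵃ
    Wᵉ = con 1ℤ :* Dᵉ :+ (:- Tᵉ) :* con 1ℤ

    ψᵉX ψᵉY : FracExpr 10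
    ψᵉX = Tᵉ , Dᵉ
    ψᵉY = x :* Wᵉ , con 1ℤ :* Dᵉ

    sᶜ : CurveExpr 10
    sᶜ = con 1ℤ + - X

    F₁ᶜ : CurveExpr 10
    F₁ᶜ = Y * stuck (# 5) (# 6) + - (X * stuck (# 7) (# 8) * (con 1ℤ + - (atom (# 2) * X)))

    F₁∘ψ : num (evalFrac F₁ ψX ψY)
         ≗ D ⊗ den (evalFrac (s ^^ m) ψX ψY) ⊗ num (evalFrac (s ^^ m) ψX ψY) ⊗ cst z ⊗ F₂
    F₁∘ψ = solve-modulo (proj₁ (evalFracExpr F₁ᶜ ψᵉX ψᵉY))
      (Dᵉ :* var (# 8) :* var (# 7) :* zᵃ :* F₂ᵉ) explained ≗-refl

    φX∘ψ : defect φX varX ψX ψY ≗ cst 0ℤ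
    φX∘ψ = solve-modulo (defectExpr (Y , sᶜ) x ψᵉX ψᵉY) (con 0ℤ) explained ≗-refl

    φY∘ψ : defect φY varY ψX ψY ≗ cst 0ℤ
    φY∘ψ = solve-modulo
      (defectExpr (con (+ 2) * atom (# 2) * X * (sᶜ * stuck (# 7) (# 8)) + - (sᶜ * stuck (# 7) (# 8))
                     + - (Y * stuck (# 5) (# 6)) , sᶜ * stuck (# 7) (# 8)) y ψᵉX ψᵉY)
      (con 0ℤ) explained ≗-refl

module Units (q : ℕ) (q-prime : Prime q) where

  open import Data.Integer as ℤ using (+_; _^_)
  import Data.Integer.Divisibility.Signed as Signed
  import Data.Integer.Properties as ℤP
  open import Data.Nat as ℕ using (suc; s≤s; z≤n)
  open import Data.Nat.Divisibility using (∣1⇒≡1; ∣⇒≤)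
  open import Data.Nat.Primality using (euclidsLemma; ¬prime[0]; ¬prime[1])
  open import Data.Sum using (inj₁; inj₂)
  open import Relation.Binary.PropositionalEquality as ≡ using (refl)

  Unit : ℤ → Set
  Unit a = ¬ ((+ q) Signed.∣ a)

  1-unit : Unit 1ℤ
  1-unit q∣1 with ∣1⇒≡1 (Signed.∣⇒∣ᵤ q∣1)
  ... | refl = ¬prime[1] q-prime

  2-unit : q % 2 ≡ 1 → Unit (+ 2)
  2-unit q-odd q∣2 with ∣⇒≤ (Signed.∣⇒∣ᵤ q∣2)
  2-unit q-odd q∣2 | z≤n         = ¬prime[0] q-prime
  2-unit q-odd q∣2 | s≤s z≤n     = ¬prime[1] q-prime
  2-unit ()    q∣2 | s≤s (s≤s z≤n)

  *-unit : ∀ {a b} → Unit a → Unit b → Unit (a ℤ.* b)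
  *-unit {a} {b} a-unit b-unit q∣ab
    with euclidsLemma ℤ.∣ a ∣ ℤ.∣ b ∣ q-prime (≡.subst (q ∣_) (ℤP.abs-* a b) (Signed.∣⇒∣ᵤ q∣ab))
  ... | inj₁ q∣a = a-unit (Signed.∣ᵤ⇒∣ q∣a)
  ... | inj₂ q∣b = b-unit (Signed.∣ᵤ⇒∣ q∣b)

  ^-unit : ∀ {a} → Unit a → ∀ n → Unit (a ^ n)
  ^-unit a-unit ℕ.zero    = 1-unit
  ^-unit a-unit (suc n)   = *-unit a-unit (^-unit a-unit n)

-- Definedness is witnessed by
-- the points (0, 0) ∈ 𝒞_z and (0, 1) ∈ 𝒞, where the denominators are
-- units: 1, 2z, or 2(z - 1).
module Birationality (m : ℕ) (z : ℤ) (q : ℕ) (q-prime : Prime q) (q-odd : q % 2 ≡ 1)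
                     (z≢0 : ¬ (z ≡ 0ℤ mod q)) (z≢1 : ¬ (z ≡ 1ℤ mod q)) where

  open Maps m z
  open IdealMembership
  open Units q q-prime
  open import Data.Integer as ℤ using (+_)
  import Data.Integer.Divisibility as Unsigned
  import Data.Integer.Divisibility.Signed as Signed
  import Data.Integer.Properties as ℤP
  open import Data.Integer.Tactic.RingSolver using (solve-∀)
  open import Data.Product using (proj₁)
  open import Relation.Binary.PropositionalEquality as ≡ using (refl)
  open SymbolicPowers using (evalFrac-^^)

  origin-on-𝒞z : valueAt 0ℤ F₁ ≡ 0ℤ
  origin-on-𝒞z = refl

  [0,1]-on-𝒞 : valueAt 1ℤ F₂ ≡ 0ℤ
  [0,1]-on-𝒞 rewrite ℤP.*-zeroʳ K = refl

  z-unit : Unit z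
  z-unit q∣z = z≢0 (≡.subst ((+ q) Unsigned.∣_) (≡.sym (ℤP.+-identityʳ z)) (Signed.∣⇒∣ᵤ q∣z))

  2z-unit : Unit (+ 2 ℤ.* z)
  2z-unit = *-unit (2-unit q-odd) z-unit

  W-unit : Unit (valueAt 1ℤ W)
  W-unit = ≡.subst Unit (≡.sym (W-value z (valueAt 1ℤ (varX ^^ m))))
    (*-unit (2-unit q-odd) (λ q∣z-1 → z≢1 (Signed.∣⇒∣ᵤ q∣z-1)))
    where
    W-value : ∀ z w → 1ℤ ℤ.* (+ 2 ℤ.* z) ℤ.+ (ℤ.- (1ℤ ℤ.+ 1ℤ ℤ.+ 0ℤ ℤ.* w)) ℤ.* 1ℤ ≡ + 2 ℤ.* (z ℤ.- 1ℤ)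
    W-value = solve-∀

  φ ψ : RatMap
  φ = φX , φY
  ψ = ψX , ψY

  φ-rational : IsRationalMap q F₁ F₂ φ
  φ-rational = not-in-ideal q 0ℤ F₁ s origin-on-𝒞z 1-unit
             , not-in-ideal q 0ℤ F₁ (s ^^ l) origin-on-𝒞z
                 (≡.subst Unit (≡.sym (valueAt-^^ 0ℤ s l)) (^-unit 1-unit l))
             , multiple-in-ideal q _ AfterΦ.F₂∘φ

  ψ-rational : IsRationalMap q F₂ F₁ ψ
  ψ-rational = not-in-ideal q 1ℤ F₂ D [0,1]-on-𝒞 2z-unit
             , not-in-ideal q 1ℤ F₂ (cst 1ℤ ⊗ D) [0,1]-on-𝒞 (*-unit 1-unit 2z-unit)
             , multiple-in-ideal q _ AfterΨ.F₁∘ψ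

  -- both composites are the identity, with denominators nonzero on the curve;
  -- the last denominator is the numerator of s^l ∘ ψ, namely W^l
  ψ∘φ≡id : CompIsId q F₁ φ ψ
  ψ∘φ≡id = (not-in-ideal q 0ℤ F₁ D origin-on-𝒞z 2z-unit , zero-in-ideal q F₁ AfterΦ.ψX∘φ)
         , (not-in-ideal q 0ℤ F₁ (cst 1ℤ ⊗ D) origin-on-𝒞z (*-unit 1-unit 2z-unit)
           , zero-in-ideal q F₁ AfterΦ.ψY∘φ)

  φ∘ψ≡id : CompIsId q F₂ ψ φ
  φ∘ψ≡id = (not-in-ideal q 1ℤ F₂ W [0,1]-on-𝒞 W-unit , zero-in-ideal q F₂ AfterΨ.φX∘ψ)
         , (≡.subst (λ p → ¬ InIdeal q F₂ (proj₁ p)) (≡.sym (evalFrac-^^ s l ψX ψY))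
              (not-in-ideal q 1ℤ F₂ (W ^^ l) [0,1]-on-𝒞
                (≡.subst Unit (≡.sym (valueAt-^^ 1ℤ W l)) (^-unit W-unit l)))
           , zero-in-ideal q F₂ AfterΨ.φY∘ψ)

theorem9p4 : (l q : ℕ) → Prime l → Prime q → l % 2 ≡ 1 → q % 2 ≡ 1 → l ∣ (q ∸ 1) →
  (z : ℤ) → ¬ (z ≡ 0ℤ mod q) → ¬ (z ≡ 1ℤ mod q) →
  BirationallyEquivalent q (curveCz l z) (curveC l z)
theorem9p4 zero    q l-prime _ _ _ _ _ _ _ = contradiction l-prime ¬prime[0]
theorem9p4 (suc m) q _ q-prime _ q-odd _ z z≢0 z≢1 =
  φ , ψ , φ-rational , ψ-rational , ψ∘φ≡id , φ∘ψ≡id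
  where open Birationality m z q q-prime q-odd z≢0 z≢1
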